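{- Let $c$ be an assertion and let $S$ be a loop-free GP 2 program. Write $\mathrm{SLP}(c,S)$ for a strongest liberal postcondition with respect to $c$ and $S$ (unique up to semantic equivalence). Then, up to semantic equivalence: 1. If $S$ is a rule set call $\mathcal{R}=\{r_1,\dots,r_n\}$, then $\mathrm{SLP}(c,\mathcal{R})=\mathrm{SLP}(c,r_1)\vee\dots\vee\mathrm{SLP}(c,r_n)$ if $n>0$, and $\mathrm{SLP}(c,\mathcal{R})=\mathsf{false}$ if $n=0$. 2. For loop-free programs $C,P,Q$: (i) $\mathrm{SLP}(c,P\ \mathtt{or}\ Q)=\mathrm{SLP}(c,P)\vee\mathrm{SLP}(c,Q)$; (ii) $\mathrm{SLP}(c,P;Q)=\mathrm{SLP}(\mathrm{SLP}(c,P),Q)$; (iii) $\mathrm{SLP}(c,\mathtt{if}\ C\ \mathtt{then}\ P\ \mathtt{else}\ Q)=\mathrm{SLP}(c\wedge\mathrm{SUCCESS}(C),P)\vee\mathrm{SLP}(c\wedge\mathrm{FAIL}(C),Q)$; (iv) $\mathrm{SLP}(c,\mathtt{try}\ C\ \mathtt{then}\ P\ \mathtt{else}\ Q)=\mathrm{SLP}(c\wedge\mathrm{SUCCESS}(C),C;P)\vee\mathrm{SLP}(c\wedge\mathrm{FAIL}(C),Q)$.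
   Context: GP 2 host graphs have finite node/edge sets, source/target maps, node/edge labels (a list of integers and strings together with a mark) and rooted/unrooted nodes. A conditional rule schema $r$ defines a relation $G\Rightarrow_r H$ on host graphs (rule application with injective match, label assignment, rule condition, dangling condition, natural double pushout). Loop-free programs are built from rule set calls $\{r_1,\dots,r_n\}$ ($n\ge0$; $\mathtt{skip}$ and $\mathtt{fail}$ are special rule set calls) using $P\ \mathtt{or}\ Q$, $P;Q$, $\mathtt{if}\ C\ \mathtt{then}\ P\ \mathtt{else}\ Q$, $\mathtt{try}\ C\ \mathtt{then}\ P\ \mathtt{else}\ Q$. $[\![P]\!]G$ is the set of outcomes (host graphs or $\mathrm{fail}$) of executing $P$ on $G$: a rule set call yields every $H$ with $G\Rightarrow_{r_i}H$ for some $i$, or $\mathrm{fail}$ if no $r_i$ applies; $P\ \mathtt{or}\ Q$ executes $P$ or $Q$ nondeterministically; $P;Q$ executes $Q$ on each graph result of $P$ (failing if $P$ fails); $\mathtt{if}\ C\ \mathtt{then}\ P\ \mathtt{else}\ Q$ executes $P$ on $G$ if some execution of $C$ on $G$ yields a graph and $Q$ on $G$ if some execution of $C$ on $G$ yields $\mathrm{fail}$; $\mathtt{try}\ C\ \mathtt{then}\ P\ \mathtt{else}\ Q$ executes $P$ on $H$ for each graph $H$ obtained by executing $C$ on $G$, and $Q$ on $G$ if some execution of $C$ on $G$ yields $\mathrm{fail}$. Assertions are arbitrary properties of host graphs, combined by $\wedge,\vee$ semantically. $G\models\mathrm{SUCCESS}(C)$ iff some host graph $H\in[\![C]\!]G$;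 $G\models\mathrm{FAIL}(C)$ iff $\mathrm{fail}\in[\![C]\!]G$. An assertion $d$ is a liberal postcondition w.r.t. $c$ and program (or rule schema) $P$ if for all host graphs $G,H$, $G\models c$ and $H\in[\![P]\!]G$ (resp. $G\Rightarrow_P H$) imply $H\models d$; a strongest liberal postcondition $\mathrm{SLP}(c,P)$ is a liberal postcondition implying every liberal postcondition. -}

module Defs where

open import Level using (Level; 0ℓ) renaming (suc to lsuc)
open import Data.Nat using (ℕ)
open import Data.Integer using (ℤ)
open import Data.String using (String)
open import Data.Bool using (Bool)
open import Data.Fin using (Fin)
open import Data.List using (List; []; _∷_; length; lookup)
open import Data.Sum using (_⊎_)
open import Data.Product using (_×_; Σ; ∃; _,_)
open import Data.Empty using (⊥)
open import Relation.Nullary using (¬_)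

-- Marks available in host graphs (dashed only for edges in GP 2).
data Mark : Set where
  none red green blue grey dashed : Mark

record Label : Set where
  constructor mkLabel
  field
    value : List (ℤ ⊎ String)
    mark  : Mark

record HostGraph : Set where
  field
    nNodes nEdges : ℕ
    source target : Fin nEdges → Fin nNodes
    nodeLabel     : Fin nNodes → Label
    edgeLabel     : Fin nEdges → Label
    rooted        : Fin nNodes → Bool

Assertion : Set₁
Assertion = HostGraph → Set

_∧ₐ_ : Assertion → Assertion → Assertion
(a ∧ₐ b) G = a G × b G

_∨ₐ_ : Assertion → Assertion → Assertion
(a ∨ₐ b) G = a G ⊎ b G

falseₐ : Assertion
falseₐ G = ⊥

⋁ₐ : ∀ {n} → (Fin n → Assertion) → Assertion
⋁ₐ {n} d G = ∃ λ (i : Fin n) → d i G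

_≡ₐ_ : Assertion → Assertion → Set
a ≡ₐ b = ∀ G → (a G → b G) × (b G → a G)

-- Rule application is taken as an abstract relation G ⇒_r H on host
-- graphs, indexed by a type of (conditional) rule schemas.

RuleApp : Set → Set₁
RuleApp Rule = HostGraph → Rule → HostGraph → Set

-- Loop-free programs over rule schemas (skip and fail are rule set calls).
data Prog (Rule : Set) : Set where
  call    : List Rule → Prog Rule
  _or_    : Prog Rule → Prog Rule → Prog Rule
  _⨾_     : Prog Rule → Prog Rule → Prog Rule
  if_then_else_  : Prog Rule → Prog Rule → Prog Rule → Prog Rule
  try_then_else_ : Prog Rule → Prog Rule → Prog Rule → Prog Rule

data Outcome : Set where
  res  : HostGraph → Outcome
  fail : Outcome

-- Sem app P G o  :  o ∈ [[P]]G
data Sem {Rule : Set} (app : RuleApp Rule) : Prog Rule → HostGraph → Outcome → Set where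
  call-res : ∀ {rs G H} (i : Fin (length rs)) → app G (lookup rs i) H →
             Sem app (call rs) G (res H)
  call-fail : ∀ {rs G} → (∀ (i : Fin (length rs)) H → ¬ app G (lookup rs i) H) →
              Sem app (call rs) G fail
  or-l : ∀ {P Q G o} → Sem app P G o → Sem app (P or Q) G o
  or-r : ∀ {P Q G o} → Sem app Q G o → Sem app (P or Q) G o
  seq-res : ∀ {P Q G H o} → Sem app P G (res H) → Sem app Q H o → Sem app (P ⨾ Q) G o
  seq-fail : ∀ {P Q G} → Sem app P G fail → Sem app (P ⨾ Q) G fail
  if-then : ∀ {C P Q G H o} → Sem app C G (res H) → Sem app P G o →
            Sem app (if C then P else Q) G o
  if-else : ∀ {C P Q G o} → Sem app C G fail → Sem app Q G o →
            Sem app (if C then P else Q) G o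
  try-then : ∀ {C P Q G H o} → Sem app C G (res H) → Sem app P H o →
             Sem app (try C then P else Q) G o
  try-else : ∀ {C P Q G o} → Sem app C G fail → Sem app Q G o →
             Sem app (try C then P else Q) G o

module _ {Rule : Set} (app : RuleApp Rule) where

  SUCCESS : Prog Rule → Assertion
  SUCCESS C G = ∃ λ H → Sem app C G (res H)

  FAIL : Prog Rule → Assertion
  FAIL C G = Sem app C G fail

  IsLiberalPost : Assertion → Prog Rule → Assertion → Set
  IsLiberalPost c P d = ∀ G H → c G → Sem app P G (res H) → d H

  IsLiberalPostRule : Assertion → Rule → Assertion → Set
  IsLiberalPostRule c r d = ∀ G H → c G → app G r H → d H

  IsSLP : Assertion → Prog Rule → Assertion → Set₁
  IsSLP c P d = IsLiberalPost c P d ×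
                (∀ (e : Assertion) → IsLiberalPost c P e → ∀ H → d H → e H)

  IsSLPRule : Assertion → Rule → Assertion → Set₁
  IsSLPRule c r d = IsLiberalPostRule c r d ×
                    (∀ (e : Assertion) → IsLiberalPostRule c r e → ∀ H → d H → e H)

module Submission where

open import Level using (0ℓ) renaming (suc to lsuc)
open import Defs
open import Data.Fin using (Fin)
open import Data.List using (List; []; length; lookup)
open import Data.Product using (_×_; _,_; ∃; proj₁; proj₂)
open import Data.Sum using (inj₁; inj₂; [_,_]′)
open import Function using (_∘_)
open import Relation.Binary.Bundles using (Setoid)
open import Relation.Binary.PropositionalEquality using (_≡_; _≢_; refl)

-- Every strongest liberal postcondition is equivalent to the image of the
-- precondition under the program, and images commute with each program
-- construct, as one sees by unfolding its semantics.

≡ₐ-setoid : Setoid (lsuc 0ℓ) 0ℓ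
≡ₐ-setoid = record
  { Carrier       = Assertion
  ; _≈_           = _≡ₐ_
  ; isEquivalence = record
    { refl  = λ G → (λ x → x) , (λ x → x)
    ; sym   = λ a≡b G → proj₂ (a≡b G) , proj₁ (a≡b G)
    ; trans = λ a≡b b≡e G → proj₁ (b≡e G) ∘ proj₁ (a≡b G) , proj₂ (a≡b G) ∘ proj₂ (b≡e G)
    }
  }

open Setoid ≡ₐ-setoid using () renaming (sym to ≡ₐ-sym)
open import Relation.Binary.Reasoning.Setoid ≡ₐ-setoid

∨ₐ-cong : ∀ {a a′ b b′ : Assertion} → a ≡ₐ a′ → b ≡ₐ b′ → (a ∨ₐ b) ≡ₐ (a′ ∨ₐ b′)
∨ₐ-cong a≡a′ b≡b′ G = [ inj₁ ∘ proj₁ (a≡a′ G) , inj₂ ∘ proj₁ (b≡b′ G) ]′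
                    , [ inj₁ ∘ proj₂ (a≡a′ G) , inj₂ ∘ proj₂ (b≡b′ G) ]′

⋁ₐ-cong : ∀ {n} {a b : Fin n → Assertion} → (∀ i → a i ≡ₐ b i) → ⋁ₐ a ≡ₐ ⋁ₐ b
⋁ₐ-cong aᵢ≡bᵢ G = (λ { (i , x) → i , proj₁ (aᵢ≡bᵢ i G) x }) , (λ { (i , x) → i , proj₂ (aᵢ≡bᵢ i G) x })

module _ {Rule : Set} (app : RuleApp Rule) where

  post : Assertion → Prog Rule → Assertion
  post c P H = ∃ λ G → c G × Sem app P G (res H)

  postRule : Assertion → Rule → Assertion
  postRule c r H = ∃ λ G → c G × app G r H

  isSLP⇒≡ₐpost : ∀ {c P d} → IsSLP app c P d → d ≡ₐ post c P
  isSLP⇒≡ₐpost {c} {P} (liberal , strongest) H =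
    strongest (post c P) (λ G _ cG s → G , cG , s) H , λ { (G , cG , s) → liberal G H cG s }

  isSLPRule⇒≡ₐpostRule : ∀ {c r d} → IsSLPRule app c r d → d ≡ₐ postRule c r
  isSLPRule⇒≡ₐpostRule {c} {r} (liberal , strongest) H =
    strongest (postRule c r) (λ G _ cG a → G , cG , a) H , λ { (G , cG , a) → liberal G H cG a }

  post-congˡ : ∀ {c c′ : Assertion} P → c ≡ₐ c′ → post c P ≡ₐ post c′ P
  post-congˡ P c≡c′ H = (λ { (G , cG , s) → G , proj₁ (c≡c′ G) cG , s })
                      , (λ { (G , cG , s) → G , proj₂ (c≡c′ G) cG , s })

  post-call : ∀ c (rs : List Rule) → post c (call rs) ≡ₐ ⋁ₐ (λ i → postRule c (lookup rs i))
  post-call c rs H = (λ { (G , cG , call-res i a) → i , G , cG , a })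
                   , (λ { (i , G , cG , a) → G , cG , call-res i a })

  post-call-[] : ∀ c → post c (call []) ≡ₐ falseₐ
  post-call-[] c H = (λ { (_ , _ , call-res () _) }) , λ ()

  post-or : ∀ c P Q → post c (P or Q) ≡ₐ (post c P ∨ₐ post c Q)
  post-or c P Q H = (λ { (G , cG , or-l s) → inj₁ (G , cG , s) ; (G , cG , or-r s) → inj₂ (G , cG , s) })
                  , [ (λ { (G , cG , s) → G , cG , or-l s }) , (λ { (G , cG , s) → G , cG , or-r s }) ]′

  post-⨾ : ∀ c P Q → post c (P ⨾ Q) ≡ₐ post (post c P) Q
  post-⨾ c P Q H = (λ { (G , cG , seq-res {H = K} s t) → K , (G , cG , s) , t })
                 , (λ { (K , (G , cG , s) , t) → G , cG , seq-res s t })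

  post-if : ∀ c C P Q → post c (if C then P else Q) ≡ₐ
            (post (c ∧ₐ SUCCESS app C) P ∨ₐ post (c ∧ₐ FAIL app C) Q)
  post-if c C P Q H =
      (λ { (G , cG , if-then {H = K} s t) → inj₁ (G , (cG , K , s) , t)
         ; (G , cG , if-else s t)         → inj₂ (G , (cG , s) , t) })
    , [ (λ { (G , (cG , _ , s) , t) → G , cG , if-then s t })
      , (λ { (G , (cG , s) , t)     → G , cG , if-else s t }) ]′

  -- The success witness recorded on the left is the very graph on which P runs.
  post-try : ∀ c C P Q → post c (try C then P else Q) ≡ₐ
             (post (c ∧ₐ SUCCESS app C) (C ⨾ P) ∨ₐ post (c ∧ₐ FAIL app C) Q)
  post-try c C P Q H =
      (λ { (G , cG , try-then {H = K} s t) → inj₁ (G , (cG , K , s) , seq-res s t)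
         ; (G , cG , try-else s t)         → inj₂ (G , (cG , s) , t) })
    , [ (λ { (G , (cG , _) , seq-res s t) → G , cG , try-then s t })
      , (λ { (G , (cG , s) , t)           → G , cG , try-else s t }) ]′

  slp-call : ∀ {c d} (rs : List Rule) {ds : Fin (length rs) → Assertion} →
             (∀ i → IsSLPRule app c (lookup rs i) (ds i)) →
             IsSLP app c (call rs) d → d ≡ₐ ⋁ₐ ds
  slp-call {c} {d} rs {ds} slpᵢ slp = begin
    d                                    ≈⟨ isSLP⇒≡ₐpost slp ⟩
    post c (call rs)                     ≈⟨ post-call c rs ⟩
    ⋁ₐ (λ i → postRule c (lookup rs i))  ≈⟨ ⋁ₐ-cong (≡ₐ-sym ∘ isSLPRule⇒≡ₐpostRule ∘ slpᵢ) ⟩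
    ⋁ₐ ds                                ∎

  slp-call-[] : ∀ {c d} → IsSLP app c (call []) d → d ≡ₐ falseₐ
  slp-call-[] {c} {d} slp = begin
    d                ≈⟨ isSLP⇒≡ₐpost slp ⟩
    post c (call []) ≈⟨ post-call-[] c ⟩
    falseₐ           ∎

  slp-or : ∀ {c d dP dQ} P Q → IsSLP app c (P or Q) d →
           IsSLP app c P dP → IsSLP app c Q dQ → d ≡ₐ (dP ∨ₐ dQ)
  slp-or {c} {d} {dP} {dQ} P Q slp slpP slpQ = begin
    d                       ≈⟨ isSLP⇒≡ₐpost slp ⟩
    post c (P or Q)         ≈⟨ post-or c P Q ⟩
    post c P ∨ₐ post c Q    ≈⟨ ∨ₐ-cong (isSLP⇒≡ₐpost slpP) (isSLP⇒≡ₐpost slpQ) ⟨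
    dP ∨ₐ dQ                ∎

  slp-⨾ : ∀ {c d dP dPQ} P Q → IsSLP app c (P ⨾ Q) d →
          IsSLP app c P dP → IsSLP app dP Q dPQ → d ≡ₐ dPQ
  slp-⨾ {c} {d} {dP} {dPQ} P Q slp slpP slpPQ = begin
    d                   ≈⟨ isSLP⇒≡ₐpost slp ⟩
    post c (P ⨾ Q)      ≈⟨ post-⨾ c P Q ⟩
    post (post c P) Q   ≈⟨ post-congˡ Q (isSLP⇒≡ₐpost slpP) ⟨
    post dP Q           ≈⟨ isSLP⇒≡ₐpost slpPQ ⟨
    dPQ                 ∎

  slp-if : ∀ {c d dP dQ} C P Q → IsSLP app c (if C then P else Q) d →
           IsSLP app (c ∧ₐ SUCCESS app C) P dP → IsSLP app (c ∧ₐ FAIL app C) Q dQ →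
           d ≡ₐ (dP ∨ₐ dQ)
  slp-if {c} {d} {dP} {dQ} C P Q slp slpP slpQ = begin
    d                                                        ≈⟨ isSLP⇒≡ₐpost slp ⟩
    post c (if C then P else Q)                              ≈⟨ post-if c C P Q ⟩
    post (c ∧ₐ SUCCESS app C) P ∨ₐ post (c ∧ₐ FAIL app C) Q  ≈⟨ ∨ₐ-cong (isSLP⇒≡ₐpost slpP) (isSLP⇒≡ₐpost slpQ) ⟨
    dP ∨ₐ dQ                                                 ∎

  slp-try : ∀ {c d dP dQ} C P Q → IsSLP app c (try C then P else Q) d →
            IsSLP app (c ∧ₐ SUCCESS app C) (C ⨾ P) dP → IsSLP app (c ∧ₐ FAIL app C) Q dQ →
            d ≡ₐ (dP ∨ₐ dQ)
  slp-try {c} {d} {dP} {dQ} C P Q slp slpP slpQ = begin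
    d                                                              ≈⟨ isSLP⇒≡ₐpost slp ⟩
    post c (try C then P else Q)                                   ≈⟨ post-try c C P Q ⟩
    post (c ∧ₐ SUCCESS app C) (C ⨾ P) ∨ₐ post (c ∧ₐ FAIL app C) Q  ≈⟨ ∨ₐ-cong (isSLP⇒≡ₐpost slpP) (isSLP⇒≡ₐpost slpQ) ⟨
    dP ∨ₐ dQ                                                       ∎

proposition5 :
  (Rule : Set) (app : RuleApp Rule) (c : Assertion) →
  -- 1. rule set calls
  ((rs : List Rule) (ds : Fin (length rs) → Assertion) →
    (∀ i → IsSLPRule app c (lookup rs i) (ds i)) →
    (d : Assertion) → IsSLP app c (call rs) d →
    (rs ≢ [] → d ≡ₐ ⋁ₐ ds) × (rs ≡ [] → d ≡ₐ falseₐ))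
  ×
  -- 2 (i) or
  ((P Q : Prog Rule) (d dP dQ : Assertion) →
    IsSLP app c (P or Q) d → IsSLP app c P dP → IsSLP app c Q dQ →
    d ≡ₐ (dP ∨ₐ dQ))
  ×
  -- 2 (ii) sequential composition
  ((P Q : Prog Rule) (d dP dPQ : Assertion) →
    IsSLP app c (P ⨾ Q) d → IsSLP app c P dP → IsSLP app dP Q dPQ →
    d ≡ₐ dPQ)
  ×
  -- 2 (iii) if-then-else
  ((C P Q : Prog Rule) (d dP dQ : Assertion) →
    IsSLP app c (if C then P else Q) d →
    IsSLP app (c ∧ₐ SUCCESS app C) P dP →
    IsSLP app (c ∧ₐ FAIL app C) Q dQ →
    d ≡ₐ (dP ∨ₐ dQ))
  ×
  -- 2 (iv) try-then-else
  ((C P Q : Prog Rule) (d dP dQ : Assertion) →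
    IsSLP app c (try C then P else Q) d →
    IsSLP app (c ∧ₐ SUCCESS app C) (C ⨾ P) dP →
    IsSLP app (c ∧ₐ FAIL app C) Q dQ →
    d ≡ₐ (dP ∨ₐ dQ))
proposition5 Rule app c =
    (λ rs ds slpᵢ d slp →
      (λ _ → slp-call app rs slpᵢ slp) , λ { refl → slp-call-[] app slp })
  , (λ P Q _ _ _ → slp-or app P Q)
  , (λ P Q _ _ _ → slp-⨾ app P Q)
  , (λ C P Q _ _ _ → slp-if app C P Q)
  , (λ C P Q _ _ _ → slp-try app C P Q)
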